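{- Let $m\geq 13$, $n\geq 16$ and let $S$ be a $2$-dominating set of $P_m\Box C_n$. With $V_1,V_2,V_3$, $S_k$, $A^S_k$, $B^S_k$ as defined in the context, $$4|S|-2\left(mn-|S|\right)\geq 4|S_1|-\left(2|A^S_1|+|B^S_1|\right)+4|S_3|-\left(2|A^S_3|+|B^S_3|\right).$$
   Context: $P_m$ is the path on $m$ vertices $a_1,\dots,a_m$ (with $a_i a_{i+1}$ adjacent) and $C_n$ the cycle on $n$ vertices $b_1,\dots,b_n$; $P_m\Box C_n$ is their Cartesian product, with vertex set $V=\{v_{ij}=(a_i,b_j): 1\le i\le m,\ 1\le j\le n\}$, where $(g_1,h_1)\sim(g_2,h_2)$ iff ($g_1=g_2$ and $h_1h_2$ is an edge) or ($g_1g_2$ is an edge and $h_1=h_2$). The $i$-th row is $\{v_{ij}:1\le j\le n\}$. Let $V_1=\{v_{ij}:1\le i\le 5\}$, $V_2=\{v_{ij}:6\le i\le m-5\}$, $V_3=\{v_{ij}: m-4\le i\le m\}$. A set $S\subseteq V$ is $2$-dominating if every vertex not in $S$ has at least two neighbors in $S$. For a $2$-dominating set $S$ put $S_k=S\cap V_k$ and, for $k\in\{1,2,3\}$, $A^S_k=\{v\in V\setminus S: v \text{ has at least two neighbors in } S_k\}$ and $B^S_k=\{v\in V\setminus S: v\text{ has exactly one neighbor in } S_k\}$. -}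

module Defs where

open import Data.Nat using (ℕ; zero; suc; _+_; _*_; _∸_; _≤_; _<_)
open import Data.Nat.Properties using (_≟_; _≤?_; _<?_)
open import Data.Fin using (Fin; toℕ)
import Data.Fin.Properties as Fin
open import Level using (0ℓ)
open import Data.Bool using (_∧_)
open import Data.Bool using (Bool; T)
open import Data.Bool.Properties using (T?)
open import Data.List using (List; length; filter; cartesianProduct; allFin)
open import Data.Product using (_×_; _,_)
open import Data.Sum using (_⊎_)
open import Relation.Nullary using (Dec; ¬_; ¬?; does)
open import Relation.Nullary.Decidable using (_×-dec_; _⊎-dec_)
open import Relation.Unary using (Pred; Decidable)
open import Relation.Binary.PropositionalEquality using (_≡_)

-- Vertex v_{ij} of P_m □ C_n is (i , j) with i : Fin m, j : Fin n
-- (0-indexed: row index toℕ i = i_paper - 1, column toℕ j = j_paper - 1).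
Vertex : ℕ → ℕ → Set
Vertex m n = Fin m × Fin n

PathAdj : ∀ {m} → Fin m → Fin m → Set
PathAdj i i' = (suc (toℕ i) ≡ toℕ i') ⊎ (suc (toℕ i') ≡ toℕ i)

pathAdj? : ∀ {m} (i i' : Fin m) → Dec (PathAdj i i')
pathAdj? i i' = (suc (toℕ i) ≟ toℕ i') ⊎-dec (suc (toℕ i') ≟ toℕ i)

CycAdj : ∀ {n} → Fin n → Fin n → Set
CycAdj {n} j j' =
  (suc (toℕ j) ≡ toℕ j') ⊎ (suc (toℕ j') ≡ toℕ j)
  ⊎ ((toℕ j ≡ 0) × (suc (toℕ j') ≡ n)) ⊎ ((toℕ j' ≡ 0) × (suc (toℕ j) ≡ n))

cycAdj? : ∀ {n} (j j' : Fin n) → Dec (CycAdj j j')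
cycAdj? {n} j j' =
  (suc (toℕ j) ≟ toℕ j') ⊎-dec (suc (toℕ j') ≟ toℕ j)
  ⊎-dec ((toℕ j ≟ 0) ×-dec (suc (toℕ j') ≟ n))
  ⊎-dec ((toℕ j' ≟ 0) ×-dec (suc (toℕ j) ≟ n))

Adj : ∀ {m n} → Vertex m n → Vertex m n → Set
Adj (i , j) (i' , j') = ((i ≡ i') × CycAdj j j') ⊎ (PathAdj i i' × (j ≡ j'))

adj? : ∀ {m n} (u v : Vertex m n) → Dec (Adj u v)
adj? (i , j) (i' , j') =
  ((i Fin.≟ i') ×-dec cycAdj? j j') ⊎-dec (pathAdj? i i' ×-dec (j Fin.≟ j'))

allV : (m n : ℕ) → List (Vertex m n)
allV m n = cartesianProduct (allFin m) (allFin n)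

count : ∀ {m n} {P : Pred (Vertex m n) 0ℓ} → Decidable P → ℕ
count {m} {n} P? = length (filter P? (allV m n))

VSet : ℕ → ℕ → Set
VSet m n = Vertex m n → Bool

_∈ₛ_ : ∀ {m n} → Vertex m n → VSet m n → Set
v ∈ₛ S = T (S v)

∈ₛ? : ∀ {m n} (S : VSet m n) → Decidable (λ v → v ∈ₛ S)
∈ₛ? S v = T? (S v)

∣_∣ₛ : ∀ {m n} → VSet m n → ℕ
∣ S ∣ₛ = count (∈ₛ? S)

nbrs : ∀ {m n} → VSet m n → Vertex m n → ℕ
nbrs S v = count (λ u → adj? u v ×-dec ∈ₛ? S u)

TwoDominating : ∀ {m n} → VSet m n → Set
TwoDominating {m} {n} S = ∀ (v : Vertex m n) → ¬ (v ∈ₛ S) → 2 ≤ nbrs S v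

-- the three row blocks (paper rows 1..5, 6..m-5, m-4..m)
data Block : Set where
  b1 b2 b3 : Block

InBlock : ∀ {m n} → Block → Vertex m n → Set
InBlock     b1 (i , _) = toℕ i < 5
InBlock {m} b2 (i , _) = (5 ≤ toℕ i) × (toℕ i + 5 < m)
InBlock {m} b3 (i , _) = m ≤ toℕ i + 5

inBlock? : ∀ {m n} (k : Block) (v : Vertex m n) → Dec (InBlock k v)
inBlock?     b1 (i , _) = toℕ i <? 5
inBlock? {m} b2 (i , _) = (5 ≤? toℕ i) ×-dec (toℕ i + 5 <? m)
inBlock? {m} b3 (i , _) = m ≤? toℕ i + 5

restrict : ∀ {m n} → VSet m n → Block → VSet m n
restrict S k v = does (inBlock? k v) ∧ S v

InA : ∀ {m n} → VSet m n → Block → Vertex m n → Set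
InA S k v = ¬ (v ∈ₛ S) × (2 ≤ nbrs (restrict S k) v)

InB : ∀ {m n} → VSet m n → Block → Vertex m n → Set
InB S k v = ¬ (v ∈ₛ S) × (nbrs (restrict S k) v ≡ 1)

∣A∣ : ∀ {m n} → VSet m n → Block → ℕ
∣A∣ S k = count (λ v → ¬? (∈ₛ? S v) ×-dec (2 ≤? nbrs (restrict S k) v))

∣B∣ : ∀ {m n} → VSet m n → Block → ℕ
∣B∣ S k = count (λ v → ¬? (∈ₛ? S v) ×-dec (nbrs (restrict S k) v ≟ 1))

-- Discharging.  Every vertex v outside S needs two units of domination, and it receives
-- min(e, 2) units from the e neighbours it has in S₁, min(e, 2) from those in S₃ and all e
-- from those in S₂.  Summed over v, the units from S₁ and S₃ are exactly 2|A_k| + |B_k|, and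
-- the units from S₂ are at most 4|S₂|, since every vertex of P_m □ C_n has degree at most 4.
-- Hence 2(mn − |S|) ≤ (2|A₁| + |B₁|) + 4|S₂| + (2|A₃| + |B₃|), which rearranges to the claim.

module Submission where

open import Level using (0ℓ)
open import Data.Bool using (Bool; true; false; _∧_; not; T)
open import Data.Empty using (⊥-elim)
open import Data.Fin using (Fin; toℕ)
import Data.Fin.Properties as Fin
open import Data.List using (List; []; _∷_; length; filter; map; _++_; cartesianProduct; allFin)
open import Data.List.Properties using (length-++; length-map; length-tabulate; filter-none)
import Data.List.Relation.Unary.All as All
open import Data.List.Relation.Unary.AllPairs using (_∷_)
open import Data.List.Relation.Unary.Unique.Propositional using (Unique)
open import Data.List.Relation.Unary.Unique.Propositional.Properties using (cartesianProduct⁺; allFin⁺)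
open import Data.Product using (_×_; _,_; proj₁; proj₂)
open import Data.Sum using (_⊎_; inj₁; inj₂)
import Data.Sum as Sum
open import Function using (_∘_; id)
open import Relation.Nullary using (Dec; yes; no; does; ¬_; ¬?)
open import Relation.Nullary.Decidable using (_×-dec_; _⊎-dec_; dec-true; dec-false)
open import Relation.Unary using (Pred; Decidable)
open import Relation.Binary.PropositionalEquality using (_≡_; refl; sym; trans; cong; cong₂; subst; subst₂; module ≡-Reasoning)

open import Defs

module Counting where

  open import Data.Nat using (ℕ; zero; suc; _+_; _*_; _⊓_; _≤_; z≤n; s≤s; _≟_; _≤?_; _<?_)
  open import Data.Nat.Properties
  open import Algebra.Properties.CommutativeSemigroup +-commutativeSemigroup using (interchange)

  ⟦_⟧ : Bool → ℕ
  ⟦ true ⟧  = 1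
  ⟦ false ⟧ = 0

  ⟦⟧-∧ : ∀ a b → ⟦ a ∧ b ⟧ ≡ ⟦ b ⟧ * ⟦ a ⟧
  ⟦⟧-∧ true  true  = refl
  ⟦⟧-∧ true  false = refl
  ⟦⟧-∧ false b     = sym (*-zeroʳ ⟦ b ⟧)

  module _ {A : Set} where

    ∑ : List A → (A → ℕ) → ℕ
    ∑ []       f = 0
    ∑ (x ∷ xs) f = f x + ∑ xs f

    ∑-cong : ∀ xs {f g : A → ℕ} → (∀ x → f x ≡ g x) → ∑ xs f ≡ ∑ xs g
    ∑-cong []       f≗g = refl
    ∑-cong (x ∷ xs) f≗g = cong₂ _+_ (f≗g x) (∑-cong xs f≗g)

    ∑-mono-≤ : ∀ xs {f g : A → ℕ} → (∀ x → f x ≤ g x) → ∑ xs f ≤ ∑ xs g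
    ∑-mono-≤ []       f≤g = z≤n
    ∑-mono-≤ (x ∷ xs) f≤g = +-mono-≤ (f≤g x) (∑-mono-≤ xs f≤g)

    ∑-zero : ∀ xs → ∑ xs (λ _ → 0) ≡ 0
    ∑-zero []       = refl
    ∑-zero (x ∷ xs) = ∑-zero xs

    ∑-distrib-+ : ∀ xs (f g : A → ℕ) → ∑ xs (λ x → f x + g x) ≡ ∑ xs f + ∑ xs g
    ∑-distrib-+ []       f g = refl
    ∑-distrib-+ (x ∷ xs) f g = trans (cong ((f x + g x) +_) (∑-distrib-+ xs f g))
                                     (interchange (f x) (g x) (∑ xs f) (∑ xs g))

    ∑-distribˡ-* : ∀ xs c (f : A → ℕ) → ∑ xs (λ x → c * f x) ≡ c * ∑ xs f
    ∑-distribˡ-* []       c f = sym (*-zeroʳ c)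
    ∑-distribˡ-* (x ∷ xs) c f =
      trans (cong (c * f x +_) (∑-distribˡ-* xs c f)) (sym (*-distribˡ-+ c (f x) (∑ xs f)))

    ∑-split₃ : ∀ xs {f g h k : A → ℕ} → (∀ x → f x ≡ g x + h x + k x) →
               ∑ xs f ≡ ∑ xs g + ∑ xs h + ∑ xs k
    ∑-split₃ xs {f} {g} {h} {k} f≗g+h+k = begin
      ∑ xs f                                 ≡⟨ ∑-cong xs f≗g+h+k ⟩
      ∑ xs (λ x → g x + h x + k x)           ≡⟨ ∑-distrib-+ xs (λ x → g x + h x) k ⟩
      ∑ xs (λ x → g x + h x) + ∑ xs k        ≡⟨ cong (_+ ∑ xs k) (∑-distrib-+ xs g h) ⟩
      ∑ xs g + ∑ xs h + ∑ xs k               ∎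
      where open ≡-Reasoning

    AtMostOne : Pred A 0ℓ → Set
    AtMostOne P = ∀ {x y} → P x → P y → x ≡ y

    module _ {P : Pred A 0ℓ} (P? : Decidable P) where

      length-filter≡∑ : ∀ xs → length (filter P? xs) ≡ ∑ xs (λ x → ⟦ does (P? x) ⟧)
      length-filter≡∑ []       = refl
      length-filter≡∑ (x ∷ xs) with does (P? x)
      ... | true  = cong suc (length-filter≡∑ xs)
      ... | false = length-filter≡∑ xs

      length-filter+length-filter-∁ : ∀ xs →
        length (filter P? xs) + length (filter (¬? ∘ P?) xs) ≡ length xs
      length-filter+length-filter-∁ []       = refl
      length-filter+length-filter-∁ (x ∷ xs) with does (P? x)
      ... | true  = cong suc (length-filter+length-filter-∁ xs)
      ... | false = trans (+-suc _ _) (cong suc (length-filter+length-filter-∁ xs))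

      length-filter-atMostOne : ∀ {xs} → Unique xs → AtMostOne P → length (filter P? xs) ≤ 1
      length-filter-atMostOne {[]}     _          _    = z≤n
      length-filter-atMostOne {x ∷ xs} (x∉ ∷ xs!) P!   with P? x
      ... | yes Px = s≤s (≤-reflexive (cong length
                       (filter-none P? (All.map (λ x≢y Py → x≢y (P! Px Py)) x∉))))
      ... | no  _  = length-filter-atMostOne xs! P!

    module _ {P Q R : Pred A 0ℓ} (P? : Decidable P) (Q? : Decidable Q) (R? : Decidable R) where

      length-filter-⊆-⊎ : (∀ {x} → P x → Q x ⊎ R x) → ∀ xs →
        length (filter P? xs) ≤ length (filter Q? xs) + length (filter R? xs)
      length-filter-⊆-⊎ P⊆Q∪R xs = begin
        length (filter P? xs)                          ≡⟨ length-filter≡∑ P? xs ⟩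
        ∑ xs (λ x → ⟦ does (P? x) ⟧)                   ≤⟨ ∑-mono-≤ xs pointwise ⟩
        ∑ xs (λ x → ⟦ does (Q? x) ⟧ + ⟦ does (R? x) ⟧) ≡⟨ ∑-distrib-+ xs _ _ ⟩
        ∑ xs (λ x → ⟦ does (Q? x) ⟧) + ∑ xs (λ x → ⟦ does (R? x) ⟧)
          ≡⟨ cong₂ _+_ (length-filter≡∑ Q? xs) (length-filter≡∑ R? xs) ⟨
        length (filter Q? xs) + length (filter R? xs)  ∎
        where
        open ≤-Reasoning
        pointwise : ∀ x → ⟦ does (P? x) ⟧ ≤ ⟦ does (Q? x) ⟧ + ⟦ does (R? x) ⟧
        pointwise x with P? x
        ... | no  _  = z≤n
        ... | yes Px with P⊆Q∪R Px
        ...   | inj₁ Qx rewrite dec-true (Q? x) Qx = s≤s z≤n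
        ...   | inj₂ Rx rewrite dec-true (R? x) Rx = m≤n+m 1 _

    module _ {P Q R S : Pred A 0ℓ} (P? : Decidable P) (Q? : Decidable Q) (R? : Decidable R) (S? : Decidable S) where

      length-filter-split₃ : (∀ x → ⟦ does (P? x) ⟧ ≡ ⟦ does (Q? x) ⟧ + ⟦ does (R? x) ⟧ + ⟦ does (S? x) ⟧) →
        ∀ xs → length (filter P? xs) ≡ length (filter Q? xs) + length (filter R? xs) + length (filter S? xs)
      length-filter-split₃ P≗Q+R+S xs = begin
        length (filter P? xs)                        ≡⟨ length-filter≡∑ P? xs ⟩
        ∑ xs (λ x → ⟦ does (P? x) ⟧)                 ≡⟨ ∑-split₃ xs P≗Q+R+S ⟩
        ∑ xs (λ x → ⟦ does (Q? x) ⟧) + ∑ xs (λ x → ⟦ does (R? x) ⟧) + ∑ xs (λ x → ⟦ does (S? x) ⟧)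
          ≡⟨ cong₂ _+_ (cong₂ _+_ (length-filter≡∑ Q? xs) (length-filter≡∑ R? xs)) (length-filter≡∑ S? xs) ⟨
        length (filter Q? xs) + length (filter R? xs) + length (filter S? xs) ∎
        where open ≡-Reasoning

  ∑-comm : ∀ {A B : Set} (xs : List A) (ys : List B) (f : A → B → ℕ) →
           ∑ xs (λ x → ∑ ys (f x)) ≡ ∑ ys (λ y → ∑ xs (λ x → f x y))
  ∑-comm []       ys f = sym (∑-zero ys)
  ∑-comm (x ∷ xs) ys f = trans (cong (∑ ys (f x) +_) (∑-comm xs ys f))
                               (sym (∑-distrib-+ ys (f x) (λ y → ∑ xs (λ x → f x y))))

  length-cartesianProduct : ∀ {A B : Set} (xs : List A) (ys : List B) →
    length (cartesianProduct xs ys) ≡ length xs * length ys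
  length-cartesianProduct []       ys = refl
  length-cartesianProduct (x ∷ xs) ys = begin
    length (map (x ,_) ys ++ cartesianProduct xs ys)        ≡⟨ length-++ (map (x ,_) ys) ⟩
    length (map (x ,_) ys) + length (cartesianProduct xs ys) ≡⟨ cong₂ _+_ (length-map (x ,_) ys) (length-cartesianProduct xs ys) ⟩
    length ys + length xs * length ys                        ∎
    where open ≡-Reasoning

  length-allV : ∀ m n → length (allV m n) ≡ m * n
  length-allV m n = trans (length-cartesianProduct (allFin m) (allFin n))
                          (cong₂ _*_ (length-tabulate {n = m} id) (length-tabulate {n = n} id))

  allV-unique : ∀ m n → Unique (allV m n)
  allV-unique m n = cartesianProduct⁺ (allFin⁺ m) (allFin⁺ n)

  inBlock : ∀ {m n} → Block → Vertex m n → Bool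
  inBlock k v = does (inBlock? k v)

  blocks-partition : ∀ {m n} → 10 ≤ m → (v : Vertex m n) →
    ⟦ inBlock b1 v ⟧ + ⟦ inBlock b2 v ⟧ + ⟦ inBlock b3 v ⟧ ≡ 1
  blocks-partition {m} m≥10 (i , _) with toℕ i <? 5 | toℕ i + 5 <? m
  ... | yes i<5 | _
    rewrite dec-true (toℕ i <? 5) i<5
          | dec-false (5 ≤? toℕ i) (<⇒≱ i<5)
          | dec-false (m ≤? toℕ i + 5) (<⇒≱ (<-≤-trans (+-monoˡ-< 5 i<5) m≥10)) = refl
  ... | no i≮5 | yes i+5<m
    rewrite dec-false (toℕ i <? 5) i≮5
          | dec-true (5 ≤? toℕ i) (≮⇒≥ i≮5)
          | dec-true (toℕ i + 5 <? m) i+5<m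
          | dec-false (m ≤? toℕ i + 5) (<⇒≱ i+5<m) = refl
  ... | no i≮5 | no i+5≮m
    rewrite dec-false (toℕ i <? 5) i≮5
          | dec-true (5 ≤? toℕ i) (≮⇒≥ i≮5)
          | dec-false (toℕ i + 5 <? m) i+5≮m
          | dec-true (m ≤? toℕ i + 5) (≮⇒≥ i+5≮m) = refl

  restrict-partition : ∀ {m n} → 10 ≤ m → (S : VSet m n) (d : Bool) (u : Vertex m n) →
    ⟦ d ∧ S u ⟧ ≡ ⟦ d ∧ restrict S b1 u ⟧ + ⟦ d ∧ restrict S b2 u ⟧ + ⟦ d ∧ restrict S b3 u ⟧
  restrict-partition m≥10 S false u = refl
  restrict-partition m≥10 S true  u = begin
    ⟦ S u ⟧                                 ≡⟨ *-identityʳ ⟦ S u ⟧ ⟨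
    ⟦ S u ⟧ * 1                             ≡⟨ cong (⟦ S u ⟧ *_) (blocks-partition m≥10 u) ⟨
    ⟦ S u ⟧ * (⟦ in₁ ⟧ + ⟦ in₂ ⟧ + ⟦ in₃ ⟧)    ≡⟨ *-distribˡ-+ ⟦ S u ⟧ (⟦ in₁ ⟧ + ⟦ in₂ ⟧) ⟦ in₃ ⟧ ⟩
    ⟦ S u ⟧ * (⟦ in₁ ⟧ + ⟦ in₂ ⟧) + ⟦ S u ⟧ * ⟦ in₃ ⟧
      ≡⟨ cong (_+ ⟦ S u ⟧ * ⟦ in₃ ⟧) (*-distribˡ-+ ⟦ S u ⟧ ⟦ in₁ ⟧ ⟦ in₂ ⟧) ⟩
    ⟦ S u ⟧ * ⟦ in₁ ⟧ + ⟦ S u ⟧ * ⟦ in₂ ⟧ + ⟦ S u ⟧ * ⟦ in₃ ⟧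
      ≡⟨ cong₂ _+_ (cong₂ _+_ (⟦⟧-∧ in₁ (S u)) (⟦⟧-∧ in₂ (S u))) (⟦⟧-∧ in₃ (S u)) ⟨
    ⟦ in₁ ∧ S u ⟧ + ⟦ in₂ ∧ S u ⟧ + ⟦ in₃ ∧ S u ⟧ ∎
    where
    open ≡-Reasoning
    in₁ = inBlock b1 u
    in₂ = inBlock b2 u
    in₃ = inBlock b3 u

  ∣∣ₛ-split : ∀ {m n} → 10 ≤ m → (S : VSet m n) →
    ∣ S ∣ₛ ≡ ∣ restrict S b1 ∣ₛ + ∣ restrict S b2 ∣ₛ + ∣ restrict S b3 ∣ₛ
  ∣∣ₛ-split {m} {n} m≥10 S =
    length-filter-split₃ (∈ₛ? S) (∈ₛ? (restrict S b1)) (∈ₛ? (restrict S b2)) (∈ₛ? (restrict S b3))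
      (restrict-partition m≥10 S true) (allV m n)

  nbrs-split : ∀ {m n} → 10 ≤ m → (S : VSet m n) (v : Vertex m n) →
    nbrs S v ≡ nbrs (restrict S b1) v + nbrs (restrict S b2) v + nbrs (restrict S b3) v
  nbrs-split {m} {n} m≥10 S v =
    length-filter-split₃ (λ u → adj? u v ×-dec ∈ₛ? S u) (λ u → adj? u v ×-dec ∈ₛ? (restrict S b1) u)
      (λ u → adj? u v ×-dec ∈ₛ? (restrict S b2) u) (λ u → adj? u v ×-dec ∈ₛ? (restrict S b3) u)
      (λ u → restrict-partition m≥10 S (does (adj? u v)) u) (allV m n)

  CycSucc : ∀ {n} → Fin n → Fin n → Set
  CycSucc {n} j j′ = (suc (toℕ j) ≡ toℕ j′) ⊎ ((toℕ j′ ≡ 0) × (suc (toℕ j) ≡ n))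

  cycSucc? : ∀ {n} (j j′ : Fin n) → Dec (CycSucc j j′)
  cycSucc? {n} j j′ = (suc (toℕ j) ≟ toℕ j′) ⊎-dec ((toℕ j′ ≟ 0) ×-dec (suc (toℕ j) ≟ n))

  cycAdj⇒cycSucc : ∀ {n} {j j′ : Fin n} → CycAdj j j′ → CycSucc j j′ ⊎ CycSucc j′ j
  cycAdj⇒cycSucc (inj₁ j→j′)               = inj₁ (inj₁ j→j′)
  cycAdj⇒cycSucc (inj₂ (inj₁ j′→j))        = inj₂ (inj₁ j′→j)
  cycAdj⇒cycSucc (inj₂ (inj₂ (inj₁ wrap))) = inj₂ (inj₂ wrap)
  cycAdj⇒cycSucc (inj₂ (inj₂ (inj₂ wrap))) = inj₁ (inj₂ wrap)

  cycSucc-functional : ∀ {n} (j : Fin n) → AtMostOne (CycSucc j)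
  cycSucc-functional j {j₁} {j₂} p q = Fin.toℕ-injective (toℕ≡ p q)
    where
    toℕ≡ : CycSucc j j₁ → CycSucc j j₂ → toℕ j₁ ≡ toℕ j₂
    toℕ≡ (inj₁ a)       (inj₁ b)       = trans (sym a) b
    toℕ≡ (inj₂ (a , _)) (inj₂ (b , _)) = trans a (sym b)
    toℕ≡ (inj₁ a)       (inj₂ (_ , c)) = ⊥-elim (<-irrefl (trans (sym a) c) (Fin.toℕ<n j₁))
    toℕ≡ (inj₂ (_ , c)) (inj₁ b)       = ⊥-elim (<-irrefl (trans (sym b) c) (Fin.toℕ<n j₂))

  cycSucc-injective : ∀ {n} (j : Fin n) → AtMostOne (λ j′ → CycSucc j′ j)
  cycSucc-injective j {j₁} {j₂} p q = Fin.toℕ-injective (toℕ≡ p q)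
    where
    toℕ≡ : CycSucc j₁ j → CycSucc j₂ j → toℕ j₁ ≡ toℕ j₂
    toℕ≡ (inj₁ a)       (inj₁ b)       = suc-injective (trans a (sym b))
    toℕ≡ (inj₂ (_ , a)) (inj₂ (_ , b)) = suc-injective (trans a (sym b))
    toℕ≡ (inj₁ a)       (inj₂ (c , _)) = ⊥-elim (1+n≢0 (trans a c))
    toℕ≡ (inj₂ (c , _)) (inj₁ b)       = ⊥-elim (1+n≢0 (trans b c))

  ≡-atMostOne : ∀ {A : Set} (a : A) → AtMostOne (a ≡_)
  ≡-atMostOne a a≡x a≡y = trans (sym a≡x) a≡y

  suc-toℕ-functional : ∀ {m} (i : Fin m) → AtMostOne (λ (i′ : Fin m) → suc (toℕ i) ≡ toℕ i′)
  suc-toℕ-functional i p q = Fin.toℕ-injective (trans (sym p) q)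

  suc-toℕ-injective : ∀ {m} (i : Fin m) → AtMostOne (λ (i′ : Fin m) → suc (toℕ i′) ≡ toℕ i)
  suc-toℕ-injective i p q = Fin.toℕ-injective (suc-injective (trans p (sym q)))

  ×-atMostOne : ∀ {A B : Set} {P : Pred A 0ℓ} {Q : Pred B 0ℓ} →
    AtMostOne P → AtMostOne Q → AtMostOne (λ (ab : A × B) → P (proj₁ ab) × Q (proj₂ ab))
  ×-atMostOne P! Q! (Pa , Qb) (Pa′ , Qb′) = cong₂ _,_ (P! Pa Pa′) (Q! Qb Qb′)

  module Neighbourhood {m n : ℕ} (i : Fin m) (j : Fin n) where

    Right Left Down Up : Pred (Vertex m n) 0ℓ
    Right v = (i ≡ proj₁ v) × CycSucc j (proj₂ v)
    Left  v = (i ≡ proj₁ v) × CycSucc (proj₂ v) j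
    Down  v = (suc (toℕ i) ≡ toℕ (proj₁ v)) × (j ≡ proj₂ v)
    Up    v = (suc (toℕ (proj₁ v)) ≡ toℕ i) × (j ≡ proj₂ v)

    right? : Decidable Right
    right? v = (i Fin.≟ proj₁ v) ×-dec cycSucc? j (proj₂ v)

    left? : Decidable Left
    left? v = (i Fin.≟ proj₁ v) ×-dec cycSucc? (proj₂ v) j

    down? : Decidable Down
    down? v = (suc (toℕ i) ≟ toℕ (proj₁ v)) ×-dec (j Fin.≟ proj₂ v)

    up? : Decidable Up
    up? v = (suc (toℕ (proj₁ v)) ≟ toℕ i) ×-dec (j Fin.≟ proj₂ v)

    adj⇒direction : ∀ {v} → Adj (i , j) v → (Right v ⊎ Left v) ⊎ (Down v ⊎ Up v)
    adj⇒direction (inj₁ (i≡i′ , j~j′))      = inj₁ (Sum.map (i≡i′ ,_) (i≡i′ ,_) (cycAdj⇒cycSucc j~j′))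
    adj⇒direction (inj₂ (inj₁ i→i′ , j≡j′)) = inj₂ (inj₁ (i→i′ , j≡j′))
    adj⇒direction (inj₂ (inj₂ i′→i , j≡j′)) = inj₂ (inj₂ (i′→i , j≡j′))

  degree≤4 : ∀ {m n} (u : Vertex m n) → length (filter (adj? u) (allV m n)) ≤ 4
  degree≤4 {m} {n} (i , j) = begin
    length (filter (adj? (i , j)) V)
      ≤⟨ length-filter-⊆-⊎ (adj? (i , j)) horizontal? vertical? adj⇒direction V ⟩
    length (filter horizontal? V) + length (filter vertical? V)
      ≤⟨ +-mono-≤ (length-filter-⊆-⊎ horizontal? right? left? id V) (length-filter-⊆-⊎ vertical? down? up? id V) ⟩
    (length (filter right? V) + length (filter left? V)) + (length (filter down? V) + length (filter up? V))
      ≤⟨ +-mono-≤ (+-mono-≤ (one right? (×-atMostOne (≡-atMostOne i) (cycSucc-functional j)))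
                            (one left?  (×-atMostOne (≡-atMostOne i) (cycSucc-injective j))))
                  (+-mono-≤ (one down?  (×-atMostOne (suc-toℕ-functional i) (≡-atMostOne j)))
                            (one up?    (×-atMostOne (suc-toℕ-injective i) (≡-atMostOne j)))) ⟩
    4 ∎
    where
    open Neighbourhood i j
    open ≤-Reasoning
    V = allV m n
    horizontal? : Decidable (λ v → Right v ⊎ Left v)
    horizontal? v = right? v ⊎-dec left? v
    vertical? : Decidable (λ v → Down v ⊎ Up v)
    vertical? v = down? v ⊎-dec up? v
    one : ∀ {P} (P? : Decidable P) → AtMostOne P → length (filter P? V) ≤ 1
    one P? = length-filter-atMostOne P? (allV-unique m n)

  ∑-nbrs≤4*∣∣ₛ : ∀ {m n} (T : VSet m n) → ∑ (allV m n) (nbrs T) ≤ 4 * ∣ T ∣ₛ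
  ∑-nbrs≤4*∣∣ₛ {m} {n} T = begin
    ∑ V (nbrs T)
      ≡⟨ ∑-cong V (λ v → length-filter≡∑ (λ u → adj? u v ×-dec ∈ₛ? T u) V) ⟩
    ∑ V (λ v → ∑ V (λ u → ⟦ does (adj? u v) ∧ T u ⟧))
      ≡⟨ ∑-comm V V (λ v u → ⟦ does (adj? u v) ∧ T u ⟧) ⟩
    ∑ V (λ u → ∑ V (λ v → ⟦ does (adj? u v) ∧ T u ⟧))
      ≡⟨ ∑-cong V (λ u → ∑-cong V (λ v → ⟦⟧-∧ (does (adj? u v)) (T u))) ⟩
    ∑ V (λ u → ∑ V (λ v → ⟦ T u ⟧ * ⟦ does (adj? u v) ⟧))
      ≡⟨ ∑-cong V (λ u → ∑-distribˡ-* V ⟦ T u ⟧ (λ v → ⟦ does (adj? u v) ⟧)) ⟩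
    ∑ V (λ u → ⟦ T u ⟧ * ∑ V (λ v → ⟦ does (adj? u v) ⟧))
      ≡⟨ ∑-cong V (λ u → cong (⟦ T u ⟧ *_) (length-filter≡∑ (adj? u) V)) ⟨
    ∑ V (λ u → ⟦ T u ⟧ * length (filter (adj? u) V))
      ≤⟨ ∑-mono-≤ V (λ u → *-monoʳ-≤ ⟦ T u ⟧ (degree≤4 u)) ⟩
    ∑ V (λ u → ⟦ T u ⟧ * 4)
      ≡⟨ ∑-cong V (λ u → *-comm ⟦ T u ⟧ 4) ⟩
    ∑ V (λ u → 4 * ⟦ T u ⟧)
      ≡⟨ ∑-distribˡ-* V 4 (λ u → ⟦ T u ⟧) ⟩
    4 * ∑ V (λ u → ⟦ T u ⟧)
      ≡⟨ cong (4 *_) (length-filter≡∑ (∈ₛ? T) V) ⟨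
    4 * ∣ T ∣ₛ ∎
    where
    open ≤-Reasoning
    V = allV m n

  k≤a+b+c⇒k≤a⊓k+b+c⊓k : ∀ k a b c → k ≤ a + b + c → k ≤ a ⊓ k + b + c ⊓ k
  k≤a+b+c⇒k≤a⊓k+b+c⊓k k a b c k≤a+b+c with ≤-total k a | ≤-total k c
  ... | inj₁ k≤a | _ = begin
    k                   ≡⟨ m≥n⇒m⊓n≡n k≤a ⟨
    a ⊓ k               ≤⟨ m≤m+n (a ⊓ k) b ⟩
    a ⊓ k + b           ≤⟨ m≤m+n (a ⊓ k + b) (c ⊓ k) ⟩
    a ⊓ k + b + c ⊓ k   ∎
    where open ≤-Reasoning
  ... | inj₂ _ | inj₁ k≤c = begin
    k                   ≡⟨ m≥n⇒m⊓n≡n k≤c ⟨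
    c ⊓ k               ≤⟨ m≤n+m (c ⊓ k) (a ⊓ k + b) ⟩
    a ⊓ k + b + c ⊓ k   ∎
    where open ≤-Reasoning
  ... | inj₂ a≤k | inj₂ c≤k rewrite m≤n⇒m⊓n≡m a≤k | m≤n⇒m⊓n≡m c≤k = k≤a+b+c

  2*⟦2≤e⟧+⟦e≡1⟧≡e⊓2 : ∀ b e → 2 * ⟦ b ∧ does (2 ≤? e) ⟧ + ⟦ b ∧ does (e ≟ 1) ⟧ ≡ ⟦ b ⟧ * (e ⊓ 2)
  2*⟦2≤e⟧+⟦e≡1⟧≡e⊓2 false e             = refl
  2*⟦2≤e⟧+⟦e≡1⟧≡e⊓2 true  zero          = refl
  2*⟦2≤e⟧+⟦e≡1⟧≡e⊓2 true  (suc zero)    = refl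
  2*⟦2≤e⟧+⟦e≡1⟧≡e⊓2 true  (suc (suc e)) rewrite ⊓-zeroʳ e = refl

  discharge : ∀ s e₁ e₂ e₃ → (¬ T s → 2 ≤ e₁ + e₂ + e₃) →
    2 * ⟦ not s ⟧ ≤ ⟦ not s ⟧ * (e₁ ⊓ 2) + e₂ + ⟦ not s ⟧ * (e₃ ⊓ 2)
  discharge true  e₁ e₂ e₃ _ = z≤n
  discharge false e₁ e₂ e₃ dominated
    rewrite *-identityˡ (e₁ ⊓ 2) | *-identityˡ (e₃ ⊓ 2) = k≤a+b+c⇒k≤a⊓k+b+c⊓k 2 e₁ e₂ e₃ (dominated λ ())

  ∣∁_∣ₛ : ∀ {m n} → VSet m n → ℕ
  ∣∁ S ∣ₛ = count (λ v → ¬? (∈ₛ? S v))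

  ∣∣ₛ+∣∁∣ₛ≡mn : ∀ {m n} (S : VSet m n) → ∣ S ∣ₛ + ∣∁ S ∣ₛ ≡ m * n
  ∣∣ₛ+∣∁∣ₛ≡mn {m} {n} S = trans (length-filter+length-filter-∁ (∈ₛ? S) (allV m n)) (length-allV m n)

  ∑-capped-nbrs≡2∣A∣+∣B∣ : ∀ {m n} (S : VSet m n) (k : Block) →
    ∑ (allV m n) (λ v → ⟦ not (S v) ⟧ * (nbrs (restrict S k) v ⊓ 2)) ≡ 2 * ∣A∣ S k + ∣B∣ S k
  ∑-capped-nbrs≡2∣A∣+∣B∣ {m} {n} S k = begin
    ∑ V (λ v → ⟦ not (S v) ⟧ * (e v ⊓ 2))
      ≡⟨ ∑-cong V (λ v → 2*⟦2≤e⟧+⟦e≡1⟧≡e⊓2 (not (S v)) (e v)) ⟨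
    ∑ V (λ v → 2 * ⟦ inA v ⟧ + ⟦ inB v ⟧)
      ≡⟨ ∑-distrib-+ V (λ v → 2 * ⟦ inA v ⟧) (λ v → ⟦ inB v ⟧) ⟩
    ∑ V (λ v → 2 * ⟦ inA v ⟧) + ∑ V (λ v → ⟦ inB v ⟧)
      ≡⟨ cong (_+ ∑ V (λ v → ⟦ inB v ⟧)) (∑-distribˡ-* V 2 (λ v → ⟦ inA v ⟧)) ⟩
    2 * ∑ V (λ v → ⟦ inA v ⟧) + ∑ V (λ v → ⟦ inB v ⟧)
      ≡⟨ cong₂ (λ a b → 2 * a + b) (length-filter≡∑ A? V) (length-filter≡∑ B? V) ⟨
    2 * ∣A∣ S k + ∣B∣ S k ∎
    where
    open ≡-Reasoning
    V = allV m n
    e : Vertex m n → ℕ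
    e = nbrs (restrict S k)
    A? = λ v → ¬? (∈ₛ? S v) ×-dec (2 ≤? e v)
    B? = λ v → ¬? (∈ₛ? S v) ×-dec (e v ≟ 1)
    inA inB : Vertex m n → Bool
    inA v = does (A? v)
    inB v = does (B? v)

  discharging : ∀ {m n} → 10 ≤ m → (S : VSet m n) → TwoDominating S →
    2 * ∣∁ S ∣ₛ ≤ (2 * ∣A∣ S b1 + ∣B∣ S b1) + 4 * ∣ restrict S b2 ∣ₛ + (2 * ∣A∣ S b3 + ∣B∣ S b3)
  discharging {m} {n} m≥10 S dominating = begin
    2 * ∣∁ S ∣ₛ
      ≡⟨ cong (2 *_) (length-filter≡∑ (λ v → ¬? (∈ₛ? S v)) V) ⟩
    2 * ∑ V (λ v → ⟦ not (S v) ⟧)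
      ≡⟨ ∑-distribˡ-* V 2 (λ v → ⟦ not (S v) ⟧) ⟨
    ∑ V (λ v → 2 * ⟦ not (S v) ⟧)
      ≤⟨ ∑-mono-≤ V (λ v → discharge (S v) (e b1 v) (e b2 v) (e b3 v)
                             (λ v∉S → subst (2 ≤_) (nbrs-split m≥10 S v) (dominating v v∉S))) ⟩
    ∑ V (λ v → w b1 v + e b2 v + w b3 v)
      ≡⟨ ∑-split₃ V (λ v → refl) ⟩
    ∑ V (w b1) + ∑ V (e b2) + ∑ V (w b3)
      ≤⟨ +-mono-≤ (+-monoʳ-≤ (∑ V (w b1)) (∑-nbrs≤4*∣∣ₛ (restrict S b2))) ≤-refl ⟩
    ∑ V (w b1) + 4 * ∣ restrict S b2 ∣ₛ + ∑ V (w b3)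
      ≡⟨ cong₂ (λ a b → a + 4 * ∣ restrict S b2 ∣ₛ + b) (∑-capped-nbrs≡2∣A∣+∣B∣ S b1) (∑-capped-nbrs≡2∣A∣+∣B∣ S b3) ⟩
    (2 * ∣A∣ S b1 + ∣B∣ S b1) + 4 * ∣ restrict S b2 ∣ₛ + (2 * ∣A∣ S b3 + ∣B∣ S b3) ∎
    where
    open ≤-Reasoning
    V = allV m n
    e : Block → Vertex m n → ℕ
    e k = nbrs (restrict S k)
    w : Block → Vertex m n → ℕ
    w k v = ⟦ not (S v) ⟧ * (e k v ⊓ 2)

open Counting using (∣∁_∣ₛ; ∣∣ₛ-split; ∣∣ₛ+∣∁∣ₛ≡mn; discharging)

open import Data.Nat using (ℕ; _≤_)
import Data.Nat as ℕ
import Data.Nat.Properties as ℕ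
open import Data.Integer using (ℤ; +_; _-_; _*_; _+_; 0ℤ; +≤+) renaming (_≤_ to _≤ℤ_)
import Data.Integer.Properties as ℤ
open import Data.Integer.Tactic.RingSolver using (solve-∀)

rearrange : ∀ {N t s₁ s₂ s₃ u c₁ c₃ : ℤ} → t ≡ s₁ + s₂ + s₃ → N ≡ t + u →
  (+ 2) * u ≤ℤ c₁ + (+ 4) * s₂ + c₃ →
  ((+ 4) * s₁ - c₁) + ((+ 4) * s₃ - c₃) ≤ℤ (+ 4) * t - (+ 2) * (N - t)
rearrange {s₁ = s₁} {s₂} {s₃} {u} {c₁} {c₃} refl refl 2u≤c₁+4s₂+c₃ = begin
  lhs                                               ≡⟨ ℤ.+-identityʳ lhs ⟨
  lhs + 0ℤ                                          ≤⟨ ℤ.+-monoʳ-≤ lhs (ℤ.i≤j⇒0≤j-i 2u≤c₁+4s₂+c₃) ⟩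
  lhs + ((c₁ + (+ 4) * s₂ + c₃) - (+ 2) * u)        ≡⟨ identity s₁ s₂ s₃ u c₁ c₃ ⟩
  (+ 4) * t - (+ 2) * ((t + u) - t)                 ∎
  where
  open ℤ.≤-Reasoning
  t = s₁ + s₂ + s₃
  lhs = ((+ 4) * s₁ - c₁) + ((+ 4) * s₃ - c₃)
  identity : ∀ s₁ s₂ s₃ u c₁ c₃ →
    ((+ 4) * s₁ - c₁) + ((+ 4) * s₃ - c₃) + ((c₁ + (+ 4) * s₂ + c₃) - (+ 2) * u)
      ≡ (+ 4) * (s₁ + s₂ + s₃) - (+ 2) * (((s₁ + s₂ + s₃) + u) - (s₁ + s₂ + s₃))
  identity = solve-∀

discharging-ℤ : ∀ {m n} → 10 ≤ m → (S : VSet m n) → TwoDominating S →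
  (+ 2) * (+ ∣∁ S ∣ₛ) ≤ℤ ((+ 2) * (+ ∣A∣ S b1) + (+ ∣B∣ S b1)) + (+ 4) * (+ ∣ restrict S b2 ∣ₛ)
                          + ((+ 2) * (+ ∣A∣ S b3) + (+ ∣B∣ S b3))
discharging-ℤ m≥10 S dominating = subst₂ _≤ℤ_ (ℤ.pos-* 2 ∣∁ S ∣ₛ)
  (trans (ℤ.pos-+ (c₁ ℕ.+ 4 ℕ.* s₂) c₃)
         (cong₂ _+_ (trans (ℤ.pos-+ c₁ (4 ℕ.* s₂)) (cong₂ _+_ (pos-2*a+b (∣A∣ S b1) (∣B∣ S b1)) (ℤ.pos-* 4 s₂)))
                    (pos-2*a+b (∣A∣ S b3) (∣B∣ S b3))))
  (+≤+ (discharging m≥10 S dominating))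
  where
  s₂ = ∣ restrict S b2 ∣ₛ
  c₁ = 2 ℕ.* ∣A∣ S b1 ℕ.+ ∣B∣ S b1
  c₃ = 2 ℕ.* ∣A∣ S b3 ℕ.+ ∣B∣ S b3
  pos-2*a+b : ∀ a b → + (2 ℕ.* a ℕ.+ b) ≡ (+ 2) * (+ a) + (+ b)
  pos-2*a+b a b = trans (ℤ.pos-+ (2 ℕ.* a) b) (cong (_+ (+ b)) (ℤ.pos-* 2 a))

lemma2p2 : ∀ (m n : ℕ) → 13 ≤ m → 16 ≤ n → (S : VSet m n) → TwoDominating S →
    ((+ 4) * (+ ∣ restrict S b1 ∣ₛ) - ((+ 2) * (+ ∣A∣ S b1) + (+ ∣B∣ S b1)))
    + ((+ 4) * (+ ∣ restrict S b3 ∣ₛ) - ((+ 2) * (+ ∣A∣ S b3) + (+ ∣B∣ S b3)))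
    ≤ℤ ((+ 4) * (+ ∣ S ∣ₛ) - (+ 2) * ((+ m) * (+ n) - (+ ∣ S ∣ₛ)))
lemma2p2 m n m≥13 _ S dominating =
  rearrange {s₁ = + s₁} {s₂ = + s₂} {s₃ = + s₃} ∣S∣-split mn-split (discharging-ℤ m≥10 S dominating)
  where
  m≥10 : 10 ≤ m
  m≥10 = ℕ.≤-trans (ℕ.m≤n+m 10 3) m≥13
  s₁ = ∣ restrict S b1 ∣ₛ
  s₂ = ∣ restrict S b2 ∣ₛ
  s₃ = ∣ restrict S b3 ∣ₛ
  ∣S∣-split : + ∣ S ∣ₛ ≡ + s₁ + + s₂ + + s₃
  ∣S∣-split = trans (cong +_ (∣∣ₛ-split m≥10 S)) (trans (ℤ.pos-+ (s₁ ℕ.+ s₂) s₃) (cong (_+ + s₃) (ℤ.pos-+ s₁ s₂)))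
  mn-split : (+ m) * (+ n) ≡ + ∣ S ∣ₛ + + ∣∁ S ∣ₛ
  mn-split = trans (sym (ℤ.pos-* m n)) (trans (cong +_ (sym (∣∣ₛ+∣∁∣ₛ≡mn S))) (ℤ.pos-+ ∣ S ∣ₛ ∣∁ S ∣ₛ))
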